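{- For all $t\in T^*$, $b\in\mathbb{F}_p$ and $c\in\mathbb{F}_p^*$, the patch $h_{b,c}$ appears in $\sigma^k(t)$ for some $k\in\mathbb{N}$.
   Context: Let $p$ be an odd prime, $\mathbb{F}_p$ the field with $p$ elements, $\mathbb{F}_p^*=\mathbb{F}_p\setminus\{0\}$. A tile is a unit equilateral triangle of the standard triangular lattice, oriented upward or downward, whose corners are decorated with elements of $\mathbb{F}_p$. $\triangle(x,y,z)$ is the upward tile with bottom-left, bottom-right, top corners $x,y,z$; $\triangledown(x,y,z)$ the downward tile with top-right, top-left, bottom corners $x,y,z$; $T$ is the set of all such tiles, $T^*=T\setminus\{\triangle(0,0,0),\triangledown(0,0,0)\}$. The substitution $\sigma$ inflates a tile by factor $2$ and replaces it by four unit tiles: $\sigma(\triangle(x,y,z))$ consists of bottom-left $\triangle(x,x+y,x+z)$, bottom-right $\triangle(x+y,y,y+z)$, top $\triangle(x+z,y+z,z)$ and central $\triangledown(y+z,x+z,x+y)$; $\sigma(\triangledown(x,y,z))$ consists of top-right $\triangledown(x,x+y,x+z)$, top-left $\triangledown(x+y,y,y+z)$, bottom $\triangledown(x+z,y+z,z)$ and central $\triangle(y+z,x+z,x+y)$. $\sigma$ acts on patches tile by tile; $\sigma^k(t)$ is a triangle of side $2^k$ made of $4^k$ decorated unit tiles (corners of tiles meeting at a common point carry a common value). For $b,c\in\mathbb{F}_p$, $h_{b,c}$ denotes the hexagonal patch of the six unit tiles sharing a common vertex, decorated with $c$ at that common vertex and $b$ at each of the six other vertices; $h_{b,c}$ appears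 in $\sigma^k(t)$ if six tiles of $\sigma^k(t)$ form this decorated hexagon. -}

module Defs where

open import Data.Nat using (ℕ; zero; suc; NonZero)
open import Data.Nat.DivMod using (_mod_)
open import Data.Fin using (Fin; toℕ)
open import Data.Integer using (ℤ; +_; _-_) renaming (_+_ to _+ℤ_; _*_ to _*ℤ_)
open import Data.List using (List; []; _∷_; concatMap)
open import Data.List.Membership.Propositional using (_∈_)
open import Data.Product using (_×_; _,_; ∃-syntax)

𝔽 : ℕ → Set
𝔽 p = Fin p

module _ {p : ℕ} .{{_ : NonZero p}} where
  infixl 6 _⊕_
  _⊕_ : 𝔽 p → 𝔽 p → 𝔽 p
  x ⊕ y = (toℕ x Data.Nat.+ toℕ y) mod p

data Orientation : Set where
  up down : Orientation

-- Lattice coordinates: the point (i , j) of ℤ² is i·e₁ + j·e₂ with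
-- e₁ = (1,0), e₂ = (1/2, √3/2).
-- An upward tile at position (a , b) has corners
--   bottom-left (a , b), bottom-right (a+1 , b), top (a , b+1).
-- A downward tile at position (a , b) has corners
--   top-right (a+1 , b+1), top-left (a , b+1), bottom (a+1 , b).
-- The three field elements are stored in the paper's order:
--   △(x,y,z): bottom-left, bottom-right, top
--   ▽(x,y,z): top-right, top-left, bottom
record PlacedTile (p : ℕ) : Set where
  constructor tile
  field
    orient : Orientation
    posA   : ℤ
    posB   : ℤ
    c₁ c₂ c₃ : 𝔽 p

Patch : ℕ → Set
Patch p = List (PlacedTile p)

△ ▽ : {p : ℕ} → 𝔽 p → 𝔽 p → 𝔽 p → PlacedTile p
△ x y z = tile up   (+ 0) (+ 0) x y z
▽ x y z = tile down (+ 0) (+ 0) x y z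

module _ {p : ℕ} .{{_ : NonZero p}} where
  two : ℤ → ℤ
  two a = + 2 *ℤ a

  σtile : PlacedTile p → Patch p
  σtile (tile up a b x y z) =
      tile up   (two a)          (two b)          x       (x ⊕ y) (x ⊕ z)
    ∷ tile up   (two a +ℤ + 1)   (two b)          (x ⊕ y) y       (y ⊕ z)
    ∷ tile up   (two a)          (two b +ℤ + 1)   (x ⊕ z) (y ⊕ z) z
    ∷ tile down (two a)          (two b)          (y ⊕ z) (x ⊕ z) (x ⊕ y)
    ∷ []
  σtile (tile down a b x y z) =
      tile down (two a +ℤ + 1)   (two b +ℤ + 1)   x       (x ⊕ y) (x ⊕ z)
    ∷ tile down (two a)          (two b +ℤ + 1)   (x ⊕ y) y       (y ⊕ z)
    ∷ tile down (two a +ℤ + 1)   (two b)          (x ⊕ z) (y ⊕ z) z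
    ∷ tile up   (two a +ℤ + 1)   (two b +ℤ + 1)   (y ⊕ z) (x ⊕ z) (x ⊕ y)
    ∷ []

  σ : Patch p → Patch p
  σ = concatMap σtile

  σ^ : ℕ → Patch p → Patch p
  σ^ zero    P = P
  σ^ (suc k) P = σ (σ^ k P)

  σ^tile : ℕ → PlacedTile p → Patch p
  σ^tile k t = σ^ k (t ∷ [])

-- h_{b,c} occurs in patch P with common vertex (a , b'): the six unit tiles
-- having (a , b') as a corner all belong to P, decorated with c at (a , b')
-- and with bb at each of the other six vertices.
HexAt : {p : ℕ} → 𝔽 p → 𝔽 p → Patch p → ℤ → ℤ → Set
HexAt bb c P a b =
    tile up   a       b       c  bb bb ∈ P   -- vertex is bottom-left
  × tile up   (a - + 1) b     bb c  bb ∈ P   -- vertex is bottom-right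
  × tile up   a (b - + 1)     bb bb c  ∈ P   -- vertex is top
  × tile down (a - + 1) (b - + 1) c  bb bb ∈ P   -- vertex is top-right
  × tile down a (b - + 1)     bb c  bb ∈ P   -- vertex is top-left
  × tile down (a - + 1) b     bb bb c  ∈ P   -- vertex is bottom

AppearsIn : {p : ℕ} → 𝔽 p → 𝔽 p → Patch p → Set
AppearsIn bb c P = ∃[ a ] ∃[ b ] HexAt bb c P a b

atOrigin : {p : ℕ} → Orientation → 𝔽 p → 𝔽 p → 𝔽 p → PlacedTile p
atOrigin o x y z = tile o (+ 0) (+ 0) x y z

-- σ acts linearly on decorations: a corner child adds the value at one corner to the other two,
-- and the central child carries the pairwise sums. Over 𝔽_p, p prime, repeating a step that
-- translates a value by some u ≠ 0 reaches every value. This drives any nonzero tile to one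
-- decorated (β, 0, β), whose image contains an up and a down tile forming the rhombus
-- 0, β, β, 0; the image of that rhombus is h_{β,2β}. The image of h_{b,c} contains h_{c+b,c},
-- so every b is reached, and every c ≠ 0 is 2β because p is odd.
module Submission where

open import Defs
open import Data.Nat using (ℕ; NonZero)
open import Data.Nat.Primality using (Prime)
open import Data.Fin using (toℕ)
open import Data.Product using (_×_; ∃-syntax)
open import Relation.Nullary using (¬_)
open import Relation.Binary.PropositionalEquality using (_≡_; _≢_)

open import Algebra.Bundles using (CommutativeMonoid)
open import Algebra.Structures.Biased using (isCommutativeMonoidˡ)
import Algebra.Properties.CommutativeMonoid.Mult as Mult
open import Data.Empty using (⊥-elim)
open import Data.Fin using (zero; suc)
open import Data.Fin.Properties using (_≟_; toℕ-fromℕ<; toℕ-injective; toℕ<n)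
open import Data.Integer using (ℤ; +_; _-_) renaming (_+_ to _+ℤ_; _*_ to _*ℤ_)
import Data.Integer.Tactic.RingSolver as ℤ-Solver
open import Data.List.Membership.Propositional using (_∈_)
open import Data.List.Membership.Propositional.Properties using (∈-concatMap⁺)
open import Data.List.Relation.Unary.Any as Any using (here; there)
open import Data.Nat using (zero; suc; _+_; _*_; _∸_; _%_)
open import Data.Nat.Coprimality using (prime⇒coprime; coprime-Bézout)
open import Data.Nat.DivMod
  using (_mod_; m%n<n; m<n⇒m%n≡m; %-distribˡ-+; %-distribˡ-*; [m+n]%n≡m%n; [m+kn]%n≡m%n)
open import Data.Nat.GCD using (module Bézout)
open import Data.Nat.Primality using (¬prime[0]; ¬prime[1])
open import Data.Nat.Properties using (+-comm; +-assoc; *-assoc; *-identityʳ; m∸n+n≡m; <⇒≤)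
import Data.Nat.Tactic.RingSolver as ℕ-Solver
open import Data.Product using (_,_; ∃₂; map₂; proj₂)
open import Function using (_∘_)
open import Level using (0ℓ)
open import Relation.Binary.PropositionalEquality
  using (refl; sym; trans; cong; cong₂; subst; subst₂; module ≡-Reasoning)
open import Relation.Binary.PropositionalEquality.Algebra using (isMagma)
open import Relation.Nullary using (yes; no)

module Modular (n : ℕ) where

  private
    p : ℕ
    p = suc n

  open ≡-Reasoning

  toℕ-mod : ∀ m → toℕ (m mod p) ≡ m % p
  toℕ-mod m = toℕ-fromℕ< (m%n<n m p)

  mod-toℕ : (x : 𝔽 p) → toℕ x mod p ≡ x
  mod-toℕ x = toℕ-injective (trans (toℕ-mod (toℕ x)) (m<n⇒m%n≡m (toℕ<n x)))

  %-≡⇒mod-≡ : ∀ m k → m % p ≡ k % p → m mod p ≡ k mod p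
  %-≡⇒mod-≡ m k eq = toℕ-injective (trans (toℕ-mod m) (trans eq (sym (toℕ-mod k))))

  mod-distrib-+ : ∀ m k → (m + k) mod p ≡ m mod p ⊕ k mod p
  mod-distrib-+ m k = %-≡⇒mod-≡ (m + k) (toℕ (m mod p) + toℕ (k mod p)) (begin
    (m + k) % p                          ≡⟨ %-distribˡ-+ m k p ⟩
    (m % p + k % p) % p                  ≡⟨ cong₂ (λ u v → (u + v) % p) (toℕ-mod m) (toℕ-mod k) ⟨
    (toℕ (m mod p) + toℕ (k mod p)) % p  ∎)

  ⊕-comm : (x y : 𝔽 p) → x ⊕ y ≡ y ⊕ x
  ⊕-comm x y = cong (_mod p) (+-comm (toℕ x) (toℕ y))

  ⊕-assoc : (x y z : 𝔽 p) → (x ⊕ y) ⊕ z ≡ x ⊕ (y ⊕ z)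
  ⊕-assoc x y z = begin
    (x ⊕ y) ⊕ z                ≡⟨ cong ((x ⊕ y) ⊕_) (mod-toℕ z) ⟨
    (X + Y) mod p ⊕ Z mod p    ≡⟨ mod-distrib-+ (X + Y) Z ⟨
    (X + Y + Z) mod p          ≡⟨ cong (_mod p) (+-assoc X Y Z) ⟩
    (X + (Y + Z)) mod p        ≡⟨ mod-distrib-+ X (Y + Z) ⟩
    X mod p ⊕ (y ⊕ z)          ≡⟨ cong (_⊕ (y ⊕ z)) (mod-toℕ x) ⟩
    x ⊕ (y ⊕ z)                ∎
    where X = toℕ x; Y = toℕ y; Z = toℕ z

  ⊕-identityˡ : (x : 𝔽 p) → zero ⊕ x ≡ x
  ⊕-identityˡ = mod-toℕ

  ⊕-identityʳ : (x : 𝔽 p) → x ⊕ zero ≡ x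
  ⊕-identityʳ x = trans (⊕-comm x zero) (⊕-identityˡ x)

  ⊕-0-commutativeMonoid : CommutativeMonoid 0ℓ 0ℓ
  ⊕-0-commutativeMonoid = record
    { _∙_ = _⊕_
    ; ε   = zero
    ; isCommutativeMonoid = isCommutativeMonoidˡ record
      { isSemigroup = record { isMagma = isMagma _⊕_ ; assoc = ⊕-assoc }
      ; identityˡ   = ⊕-identityˡ
      ; comm        = ⊕-comm
      }
    }

  open Mult ⊕-0-commutativeMonoid public using (×-distrib-+) renaming (_×_ to _·_)

  ·-mod : ∀ j (u : 𝔽 p) → j · u ≡ (j * toℕ u) mod p
  ·-mod zero    u = refl
  ·-mod (suc j) u = begin
    u ⊕ j · u                             ≡⟨ cong₂ _⊕_ (sym (mod-toℕ u)) (·-mod j u) ⟩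
    toℕ u mod p ⊕ (j * toℕ u) mod p       ≡⟨ mod-distrib-+ (toℕ u) (j * toℕ u) ⟨
    (toℕ u + j * toℕ u) mod p             ∎

  *-%-congʳ : ∀ d m k → m % p ≡ k % p → (d * m) % p ≡ (d * k) % p
  *-%-congʳ d m k eq = begin
    (d * m) % p              ≡⟨ %-distribˡ-* d m p ⟩
    (d % p * (m % p)) % p    ≡⟨ cong (λ v → (d % p * v) % p) eq ⟩
    (d % p * (k % p)) % p    ≡⟨ %-distribˡ-* d k p ⟨
    (d * k) % p              ∎

  -- In the +- case y·u ≡ −1 (mod p), and so is n = p − 1; hence n·y inverts u.
  ∃-inverse : Prime p → (u : 𝔽 p) → u ≢ zero → ∃[ v ] (v * toℕ u) % p ≡ 1 % p
  ∃-inverse _ zero u≢0 = ⊥-elim (u≢0 refl)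
  ∃-inverse p-prime u@(suc _) _
    with coprime-Bézout (prime⇒coprime p-prime (toℕ<n u))
  ... | Bézout.-+ x y eq = y , (begin
    (y * toℕ u) % p      ≡⟨ cong (_% p) eq ⟨
    (1 + x * p) % p      ≡⟨ [m+kn]%n≡m%n 1 x p ⟩
    1 % p                ∎)
  ... | Bézout.+- x y eq = n * y , (begin
    (n * y * U) % p              ≡⟨ [m+n]%n≡m%n (n * y * U) p ⟨
    (n * y * U + p) % p          ≡⟨ cong (_% p) ([n*y]*u+[1+n]≡n*[1+y*u]+1 n y U) ⟩
    (n * (1 + y * U) + 1) % p    ≡⟨ cong (λ v → (n * v + 1) % p) eq ⟩
    (n * (x * p) + 1) % p        ≡⟨ cong (_% p) (n*[x*p]+1≡1+[n*x]*p n x p) ⟩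
    (1 + n * x * p) % p          ≡⟨ [m+kn]%n≡m%n 1 (n * x) p ⟩
    1 % p                        ∎)
    where
      open ℕ-Solver
      U = toℕ u
      [n*y]*u+[1+n]≡n*[1+y*u]+1 : ∀ n y u → n * y * u + suc n ≡ n * (1 + y * u) + 1
      [n*y]*u+[1+n]≡n*[1+y*u]+1 = solve-∀
      n*[x*p]+1≡1+[n*x]*p : ∀ n x p → n * (x * p) + 1 ≡ 1 + n * x * p
      n*[x*p]+1≡1+[n*x]*p = solve-∀

  ·-surjective : Prime p → {u : 𝔽 p} → u ≢ zero → ∀ d → ∃[ j ] j · u ≡ d
  ·-surjective p-prime {u} u≢0 d with ∃-inverse p-prime u u≢0
  ... | v , vu≡1 = D * v , (begin
    (D * v) · u            ≡⟨ ·-mod (D * v) u ⟩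
    (D * v * U) mod p      ≡⟨ cong (_mod p) (*-assoc D v U) ⟩
    (D * (v * U)) mod p    ≡⟨ %-≡⇒mod-≡ (D * (v * U)) (D * 1) (*-%-congʳ D (v * U) 1 vu≡1) ⟩
    (D * 1) mod p          ≡⟨ cong (_mod p) (*-identityʳ D) ⟩
    D mod p                ≡⟨ mod-toℕ d ⟩
    d                      ∎)
    where D = toℕ d; U = toℕ u

  ∃-difference : (s t : 𝔽 p) → ∃[ d ] d ⊕ s ≡ t
  ∃-difference s t = (T + (p ∸ S)) mod p , (begin
    (T + (p ∸ S)) mod p ⊕ s          ≡⟨ cong ((T + (p ∸ S)) mod p ⊕_) (mod-toℕ s) ⟨
    (T + (p ∸ S)) mod p ⊕ S mod p    ≡⟨ mod-distrib-+ (T + (p ∸ S)) S ⟨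
    (T + (p ∸ S) + S) mod p          ≡⟨ cong (_mod p) (+-assoc T (p ∸ S) S) ⟩
    (T + (p ∸ S + S)) mod p          ≡⟨ cong (λ v → (T + v) mod p) (m∸n+n≡m (<⇒≤ (toℕ<n s))) ⟩
    (T + p) mod p                    ≡⟨ %-≡⇒mod-≡ (T + p) T ([m+n]%n≡m%n T p) ⟩
    T mod p                          ≡⟨ mod-toℕ t ⟩
    t                                ∎)
    where S = toℕ s; T = toℕ t

  ·⊕-surjective : Prime p → {u : 𝔽 p} → u ≢ zero → ∀ s t → ∃[ j ] j · u ⊕ s ≡ t
  ·⊕-surjective p-prime u≢0 s t with ∃-difference s t
  ... | d , d⊕s≡t with ·-surjective p-prime u≢0 d
  ...   | j , j·u≡d = j , trans (cong (_⊕ s) j·u≡d) d⊕s≡t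

  ∃-half : Prime p → 2 mod p ≢ zero → ∀ c → ∃[ β ] β ⊕ β ≡ c
  ∃-half p-prime 2≢0 c with ·-surjective p-prime 2≢0 c
  ... | j , j·2≡c = j · (1 mod p) , (begin
    j · (1 mod p) ⊕ j · (1 mod p)    ≡⟨ ×-distrib-+ (1 mod p) (1 mod p) j ⟨
    j · (1 mod p ⊕ 1 mod p)          ≡⟨ cong (j ·_) (mod-distrib-+ 1 1) ⟨
    j · (2 mod p)                    ≡⟨ j·2≡c ⟩
    c                                ∎)

module Inflation (n : ℕ) where

  open Modular n

  private
    p : ℕ
    p = suc n

  Motif : Set₁
  Motif = Patch p → ℤ → ℤ → Set

  TileAt : Orientation → 𝔽 p → 𝔽 p → 𝔽 p → Motif
  TileAt o x y z P a b = tile o a b x y z ∈ P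

  -- An upward and a downward tile at the same position share the edge carrying y and z;
  -- x and w are the two remaining corners.
  RhombusAt : 𝔽 p → 𝔽 p → 𝔽 p → 𝔽 p → Motif
  RhombusAt x y z w P a b = TileAt up x y z P a b × TileAt down w z y P a b

  infix 4 _⇝_
  record _⇝_ (Q R : Motif) : Set where
    constructor inflation
    field inflate : ∀ {P a b} → Q P a b → ∃₂ (R (σ P))
  open _⇝_

  opposite : Orientation → Orientation
  opposite up   = down
  opposite down = up

  pattern corner₁ = here refl
  pattern corner₂ = there (here refl)
  pattern corner₃ = there (there (here refl))
  pattern central = there (there (there (here refl)))

  ∈-σ : {t u : PlacedTile p} {P : Patch p} → t ∈ P → u ∈ σtile t → u ∈ σ P
  ∈-σ t∈P u∈σt = ∈-concatMap⁺ σtile (Any.map (λ { refl → u∈σt }) t∈P)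

  tile-≡ : ∀ {o x y z x′ y′ z′ P a b} → x ≡ x′ → y ≡ y′ → z ≡ z′ →
           TileAt o x y z P a b → TileAt o x′ y′ z′ P a b
  tile-≡ refl refl refl t = t

  rhombus-≡ : ∀ {x y z w x′ y′ z′ w′ P a b} → x ≡ x′ → y ≡ y′ → z ≡ z′ → w ≡ w′ →
              RhombusAt x y z w P a b → RhombusAt x′ y′ z′ w′ P a b
  rhombus-≡ refl refl refl refl r = r

  σ-corner₁ : ∀ {o x y z} → TileAt o x y z ⇝ TileAt o x (x ⊕ y) (x ⊕ z)
  σ-corner₁ {up}   = inflation λ t → _ , _ , ∈-σ t corner₁
  σ-corner₁ {down} = inflation λ t → _ , _ , ∈-σ t corner₁

  σ-corner₂ : ∀ {o x y z} → TileAt o x y z ⇝ TileAt o (x ⊕ y) y (y ⊕ z)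
  σ-corner₂ {up}   = inflation λ t → _ , _ , ∈-σ t corner₂
  σ-corner₂ {down} = inflation λ t → _ , _ , ∈-σ t corner₂

  σ-central : ∀ {o x y z} → TileAt o x y z ⇝ TileAt (opposite o) (y ⊕ z) (x ⊕ z) (x ⊕ y)
  σ-central {up}   = inflation λ t → _ , _ , ∈-σ t central
  σ-central {down} = inflation λ t → _ , _ , ∈-σ t central

  σ-rhombus-up : ∀ {x y z} → TileAt up x y z ⇝ RhombusAt x (x ⊕ y) (x ⊕ z) (y ⊕ z)
  σ-rhombus-up = inflation λ t → _ , _ , ∈-σ t corner₁ , ∈-σ t central

  σ-rhombus-down : ∀ {x y z} → TileAt down x y z ⇝ RhombusAt (y ⊕ z) (x ⊕ z) (x ⊕ y) x
  σ-rhombus-down = inflation λ t → _ , _ , ∈-σ t central , ∈-σ t corner₁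

  σ-rhombus-shift₂ : ∀ {x y z w} → RhombusAt x y z w ⇝ RhombusAt (y ⊕ x) y (y ⊕ z) (y ⊕ w)
  σ-rhombus-shift₂ {x} {y} {z} {w} = inflation λ (u , d) →
    _ , _ , rhombus-≡ (⊕-comm x y) refl refl (⊕-comm w y)
              (∈-σ u corner₂ , tile-≡ refl (⊕-comm z y) refl (∈-σ d corner₃))

  σ-rhombus-shift₃ : ∀ {x y z w} → RhombusAt x y z w ⇝ RhombusAt (z ⊕ x) (z ⊕ y) z (z ⊕ w)
  σ-rhombus-shift₃ {x} {y} {z} {w} = inflation λ (u , d) →
    _ , _ , rhombus-≡ (⊕-comm x z) (⊕-comm y z) refl (⊕-comm w z)
              (∈-σ u corner₃ , tile-≡ refl refl (⊕-comm z y) (∈-σ d corner₂))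

  2[m-1]+1≡2m-1 : ∀ m → + 2 *ℤ (m - + 1) +ℤ + 1 ≡ + 2 *ℤ m - + 1
  2[m-1]+1≡2m-1 = solve-∀
    where open ℤ-Solver

  2m≡[2m+1]-1 : ∀ m → + 2 *ℤ m ≡ (+ 2 *ℤ m +ℤ + 1) - + 1
  2m≡[2m+1]-1 = solve-∀
    where open ℤ-Solver

  σ-rhombus⇝hexagon : ∀ {β} → RhombusAt zero β β zero ⇝ HexAt β (β ⊕ β)
  σ-rhombus⇝hexagon {β} = inflation λ {P} {a} {b} (u , d) →
    _ , _ ,
    tile-≡ refl 0β≡β 0β≡β (∈-σ d central) ,
    subst₂ (TileAt up β (β ⊕ β) β (σ P)) (2m≡[2m+1]-1 a) refl (tile-≡ 0β≡β refl refl (∈-σ u corner₃)) ,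
    subst₂ (TileAt up β β (β ⊕ β) (σ P)) refl (2m≡[2m+1]-1 b) (tile-≡ 0β≡β refl refl (∈-σ u corner₂)) ,
    subst₂ (TileAt down (β ⊕ β) β β (σ P)) (2m≡[2m+1]-1 a) (2m≡[2m+1]-1 b) (tile-≡ refl 0β≡β 0β≡β (∈-σ u central)) ,
    subst₂ (TileAt down β (β ⊕ β) β (σ P)) refl (2m≡[2m+1]-1 b) (tile-≡ 0β≡β refl refl (∈-σ d corner₃)) ,
    subst₂ (TileAt down β β (β ⊕ β) (σ P)) (2m≡[2m+1]-1 a) refl (tile-≡ 0β≡β refl refl (∈-σ d corner₂))
    where 0β≡β = ⊕-identityˡ β

  σ-hexagon-shift : ∀ {b c} → HexAt b c ⇝ HexAt (c ⊕ b) c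
  σ-hexagon-shift {bb} {c} = inflation λ {P} {a} {b} (h₁ , h₂ , h₃ , h₄ , h₅ , h₆) →
    _ , _ ,
    ∈-σ h₁ corner₁ ,
    subst₂ (TileAt up (c ⊕ bb) c (c ⊕ bb) (σ P)) (2[m-1]+1≡2m-1 a) refl (tile-≡ b⊕c≡c⊕b refl refl (∈-σ h₂ corner₂)) ,
    subst₂ (TileAt up (c ⊕ bb) (c ⊕ bb) c (σ P)) refl (2[m-1]+1≡2m-1 b) (tile-≡ b⊕c≡c⊕b b⊕c≡c⊕b refl (∈-σ h₃ corner₃)) ,
    subst₂ (TileAt down c (c ⊕ bb) (c ⊕ bb) (σ P)) (2[m-1]+1≡2m-1 a) (2[m-1]+1≡2m-1 b) (∈-σ h₄ corner₁) ,
    subst₂ (TileAt down (c ⊕ bb) c (c ⊕ bb) (σ P)) refl (2[m-1]+1≡2m-1 b) (tile-≡ b⊕c≡c⊕b refl refl (∈-σ h₅ corner₂)) ,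
    subst₂ (TileAt down (c ⊕ bb) (c ⊕ bb) c (σ P)) (2[m-1]+1≡2m-1 a) refl (tile-≡ b⊕c≡c⊕b b⊕c≡c⊕b refl (∈-σ h₆ corner₃))
    where b⊕c≡c⊕b = ⊕-comm bb c

  module Orbit (p-prime : Prime p) (t₀ : PlacedTile p) where

    Occurs : Motif → Set
    Occurs Q = ∃[ m ] ∃₂ (Q (σ^tile m t₀))

    occurs-⇝ : ∀ {Q R} → Q ⇝ R → Occurs Q → Occurs R
    occurs-⇝ step (m , _ , _ , q) = suc m , inflate step q

    occurs-tile-≡ : ∀ {o x y z x′ y′ z′} → x ≡ x′ → y ≡ y′ → z ≡ z′ →
                    Occurs (TileAt o x y z) → Occurs (TileAt o x′ y′ z′)
    occurs-tile-≡ refl refl refl occ = occ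

    occurs-rhombus-≡ : ∀ {x y z w x′ y′ z′ w′} → x ≡ x′ → y ≡ y′ → z ≡ z′ → w ≡ w′ →
                       Occurs (RhombusAt x y z w) → Occurs (RhombusAt x′ y′ z′ w′)
    occurs-rhombus-≡ refl refl refl refl occ = occ

    occurs-translate : (M : 𝔽 p → Motif) {u : 𝔽 p} → u ≢ zero → (∀ {s} → M s ⇝ M (u ⊕ s)) →
                       ∀ {s} → Occurs (M s) → ∀ t → Occurs (M t)
    occurs-translate M {u} u≢0 step {s} occ t with ·⊕-surjective p-prime u≢0 s t
    ... | j , j·u⊕s≡t = subst (Occurs ∘ M) j·u⊕s≡t (iterate j)
      where
        iterate : ∀ j → Occurs (M (j · u ⊕ s))
        iterate zero    = subst (Occurs ∘ M) (sym (⊕-identityˡ s)) occ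
        iterate (suc j) = subst (Occurs ∘ M) (sym (⊕-assoc u (j · u) s)) (occurs-⇝ step (iterate j))

    Additive : 𝔽 p → 𝔽 p → Set
    Additive a b = ∃[ o ] Occurs (TileAt o a b (a ⊕ b))

    additive-anyˡ : ∀ {a b} → b ≢ zero → Additive a b → ∀ a′ → Additive a′ b
    additive-anyˡ {b = b} b≢0 (o , occ) a′ =
      o , occurs-translate (λ s → TileAt o s b (s ⊕ b)) b≢0 step occ a′
      where
        step : ∀ {s} → TileAt o s b (s ⊕ b) ⇝ TileAt o (b ⊕ s) b ((b ⊕ s) ⊕ b)
        step {s} = inflation λ t → map₂ (map₂ (tile-≡ (⊕-comm s b) refl (sym (⊕-assoc b s b)))) (inflate σ-corner₂ t)

    additive-anyʳ : ∀ {a b} → a ≢ zero → Additive a b → ∀ b′ → Additive a b′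
    additive-anyʳ {a} a≢0 (o , occ) b′ =
      o , occurs-translate (λ s → TileAt o a s (a ⊕ s)) a≢0 σ-corner₁ occ b′

    -- Clear the last corner by repeated corner₁ steps; the central tile is then additive.
    occurs-additive : ∀ {o x y z} → x ≢ zero → Occurs (TileAt o x y z) → ∃[ a ] Additive a x
    occurs-additive {o} {x} {y} x≢0 occ
      with occurs-translate M x≢0 step (map₂ (map₂ (map₂ (y ,_))) occ) zero
      where
        M : 𝔽 p → Motif
        M s P a b = ∃[ y′ ] TileAt o x y′ s P a b
        step : ∀ {s} → M s ⇝ M (x ⊕ s)
        step = inflation λ (y′ , t) → map₂ (map₂ (x ⊕ y′ ,_)) (inflate σ-corner₁ t)
    ... | m , a , b , y′ , t =
      y′ , opposite o ,
      occurs-tile-≡ (⊕-identityʳ y′) (⊕-identityʳ x) (⊕-comm x y′) (occurs-⇝ σ-central (m , a , b , t))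

    occurs-nonzero⇒additive : ∀ {o x y z} → ¬ (x ≡ zero × y ≡ zero × z ≡ zero) →
                              Occurs (TileAt o x y z) → ∃[ a ] ∃[ b ] b ≢ zero × Additive a b
    occurs-nonzero⇒additive {x = x} {y} {z} xyz≢0 occ with x ≟ zero | y ≟ zero | z ≟ zero
    ... | no x≢0 | _ | _ = _ , _ , x≢0 , proj₂ (occurs-additive x≢0 occ)
    ... | yes refl | no y≢0 | _ =
      _ , _ , y≢0 , proj₂ (occurs-additive y≢0 (occurs-tile-≡ (⊕-identityˡ y) refl refl (occurs-⇝ σ-corner₂ occ)))
    ... | yes refl | yes refl | no z≢0 =
      _ , _ , z≢0 , proj₂ (occurs-additive z≢0 (occurs-tile-≡ (⊕-identityˡ z) (⊕-identityˡ z) refl (occurs-⇝ σ-central occ)))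
    ... | yes refl | yes refl | yes refl = ⊥-elim (xyz≢0 (refl , refl , refl))

    additive⇒rhombus : ∀ {β} → β ≢ zero → Additive β zero → Occurs (RhombusAt zero β β zero)
    additive⇒rhombus {β} β≢0 (up , occ) =
      occurs-rhombus-≡ refl refl β⊕0≡β refl
        (occurs-translate (λ s → RhombusAt s β (β ⊕ s) s) β≢0 σ-rhombus-shift₂
          (occurs-rhombus-≡ refl β⊕0≡β (cong (β ⊕_) β⊕0≡β) (trans (⊕-identityˡ _) β⊕0≡β)
            (occurs-⇝ σ-rhombus-up occ))
          zero)
      where β⊕0≡β = ⊕-identityʳ β
    additive⇒rhombus {β} β≢0 (down , occ) =
      occurs-rhombus-≡ refl β⊕0≡β refl refl
        (occurs-translate (λ s → RhombusAt s (β ⊕ s) β s) β≢0 σ-rhombus-shift₃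
          (occurs-rhombus-≡ (trans (⊕-identityˡ _) β⊕0≡β) (cong (β ⊕_) β⊕0≡β) β⊕0≡β refl
            (occurs-⇝ σ-rhombus-down occ))
          zero)
      where β⊕0≡β = ⊕-identityʳ β

    occurs-nonzero⇒hexagon : ∀ {o x y z} → ¬ (x ≡ zero × y ≡ zero × z ≡ zero) → Occurs (TileAt o x y z) →
                             ∀ {β} → β ⊕ β ≢ zero → ∀ b → Occurs (HexAt b (β ⊕ β))
    occurs-nonzero⇒hexagon xyz≢0 occ {β} β⊕β≢0 b with occurs-nonzero⇒additive xyz≢0 occ
    ... | a , a′ , a′≢0 , additive =
      occurs-translate (λ s → HexAt s (β ⊕ β)) β⊕β≢0 σ-hexagon-shift
        (occurs-⇝ σ-rhombus⇝hexagon
          (additive⇒rhombus β≢0 (additive-anyʳ β≢0 (additive-anyˡ a′≢0 additive β) zero)))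
        b
      where
        β≢0 : β ≢ zero
        β≢0 β≡0 = β⊕β≢0 (cong (λ v → v ⊕ v) β≡0)

open Modular using (∃-half)
open Inflation using (module Orbit)

mainTheorem9 : (p : ℕ) .{{_ : NonZero p}} → Prime p → p ≢ 2 →
    (o : Orientation) (x y z : 𝔽 p) → ¬ (toℕ x ≡ 0 × toℕ y ≡ 0 × toℕ z ≡ 0) →
    (b c : 𝔽 p) → toℕ c ≢ 0 →
    ∃[ k ] AppearsIn b c (σ^tile k (atOrigin o x y z))
mainTheorem9 zero             p-prime = ⊥-elim (¬prime[0] p-prime)
mainTheorem9 (suc zero)       p-prime = ⊥-elim (¬prime[1] p-prime)
mainTheorem9 (suc (suc zero)) _ p≢2   = ⊥-elim (p≢2 refl)
mainTheorem9 (suc n@(suc (suc _))) p-prime _ o x y z xyz≢0 b c c≢0 with ∃-half n p-prime (λ ()) c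
... | β , refl =
  occurs-nonzero⇒hexagon
    (λ (x≡0 , y≡0 , z≡0) → xyz≢0 (cong toℕ x≡0 , cong toℕ y≡0 , cong toℕ z≡0))
    (0 , + 0 , + 0 , here refl)
    {β} (c≢0 ∘ cong toℕ) b
  where open Orbit n p-prime (atOrigin o x y z)
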